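{- Let $(b_n)_{n\in\mathbb Z}$ be a lens sequence with constant $\beta$. Then for every $n$ with $b_{n-1}\neq0$, $$b_{n+2}=\frac{(b_{n+1}-\beta)(b_n-\beta)}{b_{n-1}}.$$
   Context: A lens sequence is a bilateral real sequence $(b_n)_{n\in\mathbb Z}$ obtained from a seed $(a,b,c)$ with $b\neq0$ placed at three consecutive positions, extended in both directions by $b_n=\alpha b_{n-1}-b_{n-2}+\beta$, where $\alpha=\frac{ab+bc+ca}{b^2}-1$ and $\beta=\frac{b^2-ac}{b}$; these constants do not depend on the choice of the three consecutive terms. -}

module Defs where

open import Level using (Level; _⊔_; suc)
open import Algebra.Bundles using (CommutativeRing)
open import Relation.Nullary using (¬_)
open import Data.Integer using (ℤ; +_) renaming (_+_ to _+ℤ_; _-_ to _-ℤ_)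
open import Data.Product using (_×_)

record Field (c ℓ : Level) : Set (suc (c ⊔ ℓ)) where
  field
    commutativeRing : CommutativeRing c ℓ
  open CommutativeRing commutativeRing public
  field
    0≉1   : ¬ (0# ≈ 1#)
    inv   : (x : Carrier) → ¬ (x ≈ 0#) → Carrier
    inv-r : (x : Carrier) (p : ¬ (x ≈ 0#)) → x * inv x p ≈ 1#

module _ {c ℓ : Level} (F : Field c ℓ) where
  open Field F

  lensα : (a b c : Carrier) → ¬ (b ≈ 0#) → Carrier
  lensα a b c p = ((a * b + b * c) + c * a) * (inv b p * inv b p) - 1#

  lensβ : (a b c : Carrier) → ¬ (b ≈ 0#) → Carrier
  lensβ a b c p = (b * b - a * c) * inv b p

  seqα : (s : ℤ → Carrier) (k : ℤ) → ¬ (s (k +ℤ + 1) ≈ 0#) → Carrier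
  seqα s k p = lensα (s k) (s (k +ℤ + 1)) (s (k +ℤ + 2)) p

  seqβ : (s : ℤ → Carrier) (k : ℤ) → ¬ (s (k +ℤ + 1) ≈ 0#) → Carrier
  seqβ s k p = lensβ (s k) (s (k +ℤ + 1)) (s (k +ℤ + 2)) p

  -- s is the lens sequence generated by the seed (s k, s (k+1), s (k+2)),
  -- s (k+1) ≠ 0: it satisfies the recurrence
  --   s n = α s (n-1) - s (n-2) + β   for every n ∈ ℤ
  -- (this determines s in both directions from the seed).
  IsLensSeq : (s : ℤ → Carrier) (k : ℤ) → ¬ (s (k +ℤ + 1) ≈ 0#) → Set ℓ
  IsLensSeq s k p = ∀ (n : ℤ) →
    s n ≈ (seqα s k p * s (n -ℤ + 1) - s (n -ℤ + 2)) + seqβ s k p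

-- Along a lens sequence the quantity b(m) b(m+2) + β b(m+1) - b(m+1)² is constant: its
-- increment is a combination of two instances of the linear recurrence.  It vanishes at
-- the seed by the very definition of β, hence everywhere.  Multiplying the recurrence
-- b(n+2) = α b(n+1) - b(n) + β by b(n-1) and eliminating α b(n-1) b(n+1) with this
-- quadratic relation gives b(n-1) b(n+2) = (b(n+1) - β)(b(n) - β).
module Submission where

open import Defs
open import Level using (Level)
open import Relation.Nullary using (¬_)
open import Data.Integer using (ℤ; +_; -[1+_]) renaming (_+_ to _+ℤ_; _-_ to _-ℤ_)
open import Data.Nat using (zero; suc)
open import Algebra.Bundles using (AbelianGroup; CommutativeRing)
open import Relation.Binary.PropositionalEquality as ≡ using (_≡_)
import Data.Integer.Properties as ℤₚ
import Data.Integer.Tactic.RingSolver as ℤ-Solver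
import Algebra.Properties.AbelianGroup as AbelianGroupProperties
import Algebra.Properties.Ring as RingProperties
import Algebra.Solver.Ring.NaturalCoefficients.Default as NaturalCoefficientsSolver
import Relation.Binary.Reasoning.Setoid as SetoidReasoning

+1-shift : ∀ d k → (d +ℤ k) +ℤ + 1 ≡ (+ 1 +ℤ d) +ℤ k
+1-shift = ℤ-Solver.solve-∀

m-k+k≡m : ∀ m k → (m -ℤ k) +ℤ k ≡ m
m-k+k≡m = ℤ-Solver.solve-∀

m+1+1-1≡m+1 : ∀ m → ((m +ℤ + 1) +ℤ + 1) -ℤ + 1 ≡ m +ℤ + 1
m+1+1-1≡m+1 = ℤ-Solver.solve-∀

m+1+1-2≡m : ∀ m → ((m +ℤ + 1) +ℤ + 1) -ℤ + 2 ≡ m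
m+1+1-2≡m = ℤ-Solver.solve-∀

m+1+1≡m+2 : ∀ m → (m +ℤ + 1) +ℤ + 1 ≡ m +ℤ + 2
m+1+1≡m+2 = ℤ-Solver.solve-∀

m-1+1≡m : ∀ m → (m -ℤ + 1) +ℤ + 1 ≡ m
m-1+1≡m = ℤ-Solver.solve-∀

m-1+1+1≡m+1 : ∀ m → ((m -ℤ + 1) +ℤ + 1) +ℤ + 1 ≡ m +ℤ + 1
m-1+1+1≡m+1 = ℤ-Solver.solve-∀

m-1+1+1+1≡m+2 : ∀ m → (((m -ℤ + 1) +ℤ + 1) +ℤ + 1) +ℤ + 1 ≡ m +ℤ + 2
m-1+1+1+1≡m+2 = ℤ-Solver.solve-∀

bi-induction : ∀ {p} (P : ℤ → Set p) (k : ℤ) → P k →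
               (∀ m → P m → P (m +ℤ + 1)) → (∀ m → P (m +ℤ + 1) → P m) →
               ∀ m → P m
bi-induction P k base up down m = ≡.subst P (m-k+k≡m m k) (from-k (m -ℤ k))
  where
  -- For d in constructor form, + 1 +ℤ d computes to the successor of d.
  from-k : ∀ d → P (d +ℤ k)
  from-k (+ zero)      = ≡.subst P (≡.sym (ℤₚ.+-identityˡ k)) base
  from-k (+ suc j)     = ≡.subst P (+1-shift (+ j) k) (up _ (from-k (+ j)))
  from-k -[1+ zero ]   = down _ (≡.subst P (≡.sym (+1-shift -[1+ 0 ] k)) (from-k (+ zero)))
  from-k -[1+ suc j ]  = down _ (≡.subst P (≡.sym (+1-shift -[1+ suc j ] k)) (from-k -[1+ j ]))

module _ {c ℓ : Level} (G : AbelianGroup c ℓ) where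
  open AbelianGroup G
  open AbelianGroupProperties G using (∙-cancelʳ)

  -- "Balanced" says that f - g is constant, so agreement at one point spreads.
  balanced-agreement : (f g : ℤ → Carrier) (k : ℤ) →
                       (∀ m → f (m +ℤ + 1) ∙ g m ≈ f m ∙ g (m +ℤ + 1)) →
                       f k ≈ g k → ∀ m → f m ≈ g m
  balanced-agreement f g k balanced fk≈gk =
    bi-induction (λ m → f m ≈ g m) k fk≈gk forward backward
    where
    forward : ∀ m → f m ≈ g m → f (m +ℤ + 1) ≈ g (m +ℤ + 1)
    forward m fm≈gm =
      ∙-cancelʳ (g m) _ _ (trans (balanced m) (trans (∙-congʳ fm≈gm) (comm _ _)))

    backward : ∀ m → f (m +ℤ + 1) ≈ g (m +ℤ + 1) → f m ≈ g m
    backward m fm+1≈gm+1 = sym (∙-cancelʳ (f (m +ℤ + 1)) _ _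
      (trans (comm _ _) (trans (balanced m) (∙-congˡ (sym fm+1≈gm+1)))))

module _ {c ℓ : Level} (R : CommutativeRing c ℓ) where
  open CommutativeRing R
  open RingProperties ring using (+-cancelʳ; //-rightDividesˡ)
  open NaturalCoefficientsSolver commutativeSemiring using (solve; _:=_; _:+_; _:*_)
  open SetoidReasoning setoid

  x≈y-z+w⇒x+z≈y+w : ∀ {x y z w} → x ≈ (y - z) + w → x + z ≈ y + w
  x≈y-z+w⇒x+z≈y+w {x} {y} {z} {w} x≈y-z+w = begin
    x + z                ≈⟨ +-congʳ x≈y-z+w ⟩
    ((y - z) + w) + z    ≈⟨ solve 3 (λ d w z → (d :+ w) :+ z := (d :+ z) :+ w) refl (y - z) w z ⟩
    ((y - z) + z) + w    ≈⟨ +-congʳ (//-rightDividesˡ z y) ⟩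
    y + w                ∎

  [x-a]*[y-a]+a*[x+y]≈x*y+a*a : ∀ x y a → (x - a) * (y - a) + a * (x + y) ≈ x * y + a * a
  [x-a]*[y-a]+a*[x+y]≈x*y+a*a x y a = +-cancelʳ (a * (a - a)) _ _ (begin
    ((x - a) * (y - a) + a * (x + y)) + a * (a - a)
      ≈⟨ solve 4 (λ x y a n → ((x :+ n) :* (y :+ n) :+ a :* (x :+ y)) :+ a :* (a :+ n)
                            := (x :* y :+ a :* a) :+ (a :+ n) :* ((x :+ y) :+ n)) refl x y a (- a) ⟩
    (x * y + a * a) + (a - a) * ((x + y) - a)
      ≈⟨ +-congˡ (trans (*-congʳ (-‿inverseʳ a)) (zeroˡ _)) ⟩
    (x * y + a * a) + 0#
      ≈⟨ +-congˡ (trans (*-congˡ (-‿inverseʳ a)) (zeroʳ a)) ⟨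
    (x * y + a * a) + a * (a - a) ∎)

  -- Read x, y, z, w as four consecutive terms of b(n) + b(n-2) = α b(n-1) + β.
  module _ {α β x y z w : Carrier}
           (rec₁ : z + x ≈ α * y + β) (rec₂ : w + y ≈ α * z + β) where

    quadratic-relation-balanced : (y * w + β * z) + y * y ≈ (x * z + β * y) + z * z
    quadratic-relation-balanced = begin
      (y * w + β * z) + y * y    ≈⟨ solve 4 (λ y w z β → (y :* w :+ β :* z) :+ y :* y
                                                       := y :* (w :+ y) :+ β :* z) refl y w z β ⟩
      y * (w + y) + β * z        ≈⟨ +-congʳ (*-congˡ rec₂) ⟩
      y * (α * z + β) + β * z    ≈⟨ solve 4 (λ y α z β → y :* (α :* z :+ β) :+ β :* z
                                                       := z :* (α :* y :+ β) :+ β :* y) refl y α z β ⟩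
      z * (α * y + β) + β * y    ≈⟨ +-congʳ (*-congˡ rec₁) ⟨
      z * (z + x) + β * y        ≈⟨ solve 4 (λ z x β y → z :* (z :+ x) :+ β :* y
                                                       := (x :* z :+ β :* y) :+ z :* z) refl z x β y ⟩
      (x * z + β * y) + z * z    ∎

    -- Both sides are shifted by x y + β x + α β y so that no subtraction occurs and the
    -- natural-coefficient solver applies.
    lens-product-expanded : x * z + β * y ≈ y * y → x * w + β * (z + y) ≈ z * y + β * β
    lens-product-expanded quadratic = +-cancelʳ (x * y + β * x + α * β * y) _ _ (begin
      (x * w + β * (z + y)) + (x * y + β * x + α * β * y)
        ≈⟨ solve 6 (λ x w β y z α → (x :* w :+ β :* (z :+ y)) :+ (x :* y :+ β :* x :+ α :* β :* y)
                    := x :* (w :+ y) :+ β :* (z :+ x) :+ β :* y :+ α :* β :* y) refl x w β y z α ⟩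
      x * (w + y) + β * (z + x) + β * y + α * β * y
        ≈⟨ +-congʳ (+-congʳ (+-cong (*-congˡ rec₂) (*-congˡ rec₁))) ⟩
      x * (α * z + β) + β * (α * y + β) + β * y + α * β * y
        ≈⟨ solve 5 (λ x β y z α → x :* (α :* z :+ β) :+ β :* (α :* y :+ β) :+ β :* y :+ α :* β :* y
                    := α :* (x :* z :+ β :* y) :+ β :* x :+ β :* y :+ α :* β :* y :+ β :* β) refl x β y z α ⟩
      α * (x * z + β * y) + β * x + β * y + α * β * y + β * β
        ≈⟨ +-congʳ (+-congʳ (+-congʳ (+-congʳ (*-congˡ quadratic)))) ⟩
      α * (y * y) + β * x + β * y + α * β * y + β * β
        ≈⟨ solve 4 (λ x β y α → α :* (y :* y) :+ β :* x :+ β :* y :+ α :* β :* y :+ β :* β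
                    := y :* (α :* y :+ β) :+ β :* x :+ α :* β :* y :+ β :* β) refl x β y α ⟩
      y * (α * y + β) + β * x + α * β * y + β * β
        ≈⟨ +-congʳ (+-congʳ (+-congʳ (*-congˡ rec₁))) ⟨
      y * (z + x) + β * x + α * β * y + β * β
        ≈⟨ solve 5 (λ x β y z α → y :* (z :+ x) :+ β :* x :+ α :* β :* y :+ β :* β
                    := (z :* y :+ β :* β) :+ (x :* y :+ β :* x :+ α :* β :* y)) refl x β y z α ⟩
      (z * y + β * β) + (x * y + β * x + α * β * y) ∎)

    lens-product : x * z + β * y ≈ y * y → x * w ≈ (z - β) * (y - β)
    lens-product quadratic = +-cancelʳ (β * (z + y)) _ _
      (trans (lens-product-expanded quadratic) (sym ([x-a]*[y-a]+a*[x+y]≈x*y+a*a z y β)))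

module _ {c ℓ : Level} (F : Field c ℓ) where
  open Field F
  open NaturalCoefficientsSolver commutativeSemiring using (solve; _:=_; _:+_; _:*_)
  open RingProperties ring using (//-rightDividesˡ)
  open SetoidReasoning setoid

  x*y≈z⇒y≈z*x⁻¹ : ∀ {x y z} → x * y ≈ z → (x≉0 : ¬ (x ≈ 0#)) → y ≈ z * inv x x≉0
  x*y≈z⇒y≈z*x⁻¹ {x} {y} {z} x*y≈z x≉0 = begin
    y                      ≈⟨ *-identityʳ y ⟨
    y * 1#                 ≈⟨ *-congˡ (inv-r x x≉0) ⟨
    y * (x * inv x x≉0)    ≈⟨ solve 3 (λ x y i → y :* (x :* i) := (x :* y) :* i) refl x y (inv x x≉0) ⟩
    (x * y) * inv x x≉0    ≈⟨ *-congʳ x*y≈z ⟩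
    z * inv x x≉0          ∎

  lensβ-relation : ∀ a b c (b≉0 : ¬ (b ≈ 0#)) → a * c + lensβ F a b c b≉0 * b ≈ b * b
  lensβ-relation a b c b≉0 = begin
    a * c + (d * i) * b    ≈⟨ solve 5 (λ a c d i b → a :* c :+ (d :* i) :* b := d :* (b :* i) :+ a :* c) refl a c d i b ⟩
    d * (b * i) + a * c    ≈⟨ +-congʳ (trans (*-congˡ (inv-r b b≉0)) (*-identityʳ d)) ⟩
    d + a * c              ≈⟨ //-rightDividesˡ (a * c) (b * b) ⟩
    b * b                  ∎
    where
    d = b * b - a * c
    i = inv b b≉0

  module LensSequence (s : ℤ → Carrier) (k : ℤ) (seed≉0 : ¬ (s (k +ℤ + 1) ≈ 0#))
                      (lens : IsLensSeq F s k seed≉0) where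
    α = seqα F s k seed≉0
    β = seqβ F s k seed≉0

    infix 10 _⁺
    _⁺ : ℤ → ℤ
    m ⁺ = m +ℤ + 1

    s-cong : ∀ {i j} → i ≡ j → s i ≈ s j
    s-cong i≡j = reflexive (≡.cong s i≡j)

    recurrence : ∀ m → s (m ⁺ ⁺) + s m ≈ α * s (m ⁺) + β
    recurrence m = x≈y-z+w⇒x+z≈y+w commutativeRing
      (≡.subst₂ (λ i j → s (m ⁺ ⁺) ≈ (α * s i - s j) + β) (m+1+1-1≡m+1 m) (m+1+1-2≡m m) (lens (m ⁺ ⁺)))

    quadratic-relation : ∀ m → s m * s (m ⁺ ⁺) + β * s (m ⁺) ≈ s (m ⁺) * s (m ⁺)
    quadratic-relation = balanced-agreement +-abelianGroup
      (λ m → s m * s (m ⁺ ⁺) + β * s (m ⁺)) (λ m → s (m ⁺) * s (m ⁺)) k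
      (λ m → quadratic-relation-balanced commutativeRing (recurrence m) (recurrence (m ⁺)))
      (trans (+-congʳ (*-congˡ (s-cong (m+1+1≡m+2 k))))
             (lensβ-relation (s k) (s (k ⁺)) (s (k +ℤ + 2)) seed≉0))

    product : ∀ m → s m * s (m ⁺ ⁺ ⁺) ≈ (s (m ⁺ ⁺) - β) * (s (m ⁺) - β)
    product m = lens-product commutativeRing (recurrence m) (recurrence (m ⁺)) (quadratic-relation m)

proposition5p12 : ∀ {c ℓ : Level} (F : Field c ℓ) →
    let open Field F in
    (s : ℤ → Carrier) (k : ℤ) (p : ¬ (s (k +ℤ + 1) ≈ 0#)) →
    IsLensSeq F s k p →
    (n : ℤ) (q : ¬ (s (n -ℤ + 1) ≈ 0#)) →
    s (n +ℤ + 2) ≈ ((s (n +ℤ + 1) - seqβ F s k p) * (s n - seqβ F s k p)) * inv (s (n -ℤ + 1)) q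
proposition5p12 F s k p lens n q = begin
  s (n +ℤ + 2)
    ≈⟨ s-cong (m-1+1+1+1≡m+2 n) ⟨
  s ((n -ℤ + 1) ⁺ ⁺ ⁺)
    ≈⟨ x*y≈z⇒y≈z*x⁻¹ F (product (n -ℤ + 1)) q ⟩
  ((s ((n -ℤ + 1) ⁺ ⁺) - β) * (s ((n -ℤ + 1) ⁺) - β)) * inv (s (n -ℤ + 1)) q
    ≈⟨ *-congʳ (*-cong (+-congʳ (s-cong (m-1+1+1≡m+1 n))) (+-congʳ (s-cong (m-1+1≡m n)))) ⟩
  ((s (n +ℤ + 1) - β) * (s n - β)) * inv (s (n -ℤ + 1)) q ∎
  where
  open Field F
  open LensSequence F s k p lens
  open SetoidReasoning setoid
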